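{- Let $p$ be a prime and $n\geq 1$. For each tuple $(e_1,\dots,e_n)\in\{0,\dots,p-1\}^n$ let $q_{e_1,\dots,e_n}(x)$ be an integer polynomial. If $$\sum_{(e_1,\dots,e_n)\in\{0,\dots,p-1\}^n}\left(\prod_{i=1}^n\left(\widetilde{\mathcal{G}}_{p,i}(x)\right)^{e_i}q_{e_1,\dots,e_n}(x)\right)\equiv 0\pmod p$$ holds for every integer $x$, then every $q_{e_1,\dots,e_n}(x)$ is a null polynomial modulo $p$.
   Context: An integer polynomial $f$ is a null polynomial modulo $m$ if $f(x)\equiv 0\pmod m$ for all integers $x$. For a prime $p$: $I_p(0)=0$, $I_p(n)=\frac{p^n-1}{p-1}$; $\mathcal{G}_{p,0}(x)=x$, $\mathcal{G}_{p,n}(x)=\prod_{i=0}^{p-1}\left(\mathcal{G}_{p,n-1}(x)-ip^{I_p(n-1)}\right)$ for $n\ge1$; and $\widetilde{\mathcal{G}}_{p,n}(x)=\mathcal{G}_{p,n}(x)/p^{I_p(n)}$, a rational polynomial which takes integer values at all integers (equivalently $\widetilde{\mathcal{G}}_{p,0}(x)=x$, $\widetilde{\mathcal{G}}_{p,n}(x)=\frac{1}{p}\prod_{i=0}^{p-1}(\widetilde{\mathcal{G}}_{p,n-1}(x)-i)$). -}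

module Defs where

open import Data.Nat using (ℕ; zero; suc)
open import Data.Integer using (ℤ; +_; _+_; _-_; _*_; _^_)
open import Data.Integer.DivMod using (_/ℕ_)
open import Data.Integer.Divisibility using (_∣_)
open import Data.Fin using (Fin; toℕ)
open import Data.Vec using (Vec; []; _∷_)
open import Data.List using (List; []; _∷_; map; concatMap)
open import Data.Fin using (Fin; zero; suc)
open import Data.List using (allFin)

-- An integer polynomial, given by its list of coefficients (constant term first).
IntPoly : Set
IntPoly = List ℤ

eval : IntPoly → ℤ → ℤ
eval []       x = + 0
eval (c ∷ cs) x = c + x * eval cs x

NullMod : IntPoly → ℕ → Set
NullMod f m = ∀ (x : ℤ) → (+ m) ∣ eval f x

-- Exact division by the natural number d (used only with d = p prime,
-- where the division is exact); division by 0 is set to 0 (never used).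
divBy : ℤ → ℕ → ℤ
divBy z zero    = + 0
divBy z (suc k) = z /ℕ suc k

fallingProd : ℤ → ℕ → ℤ
fallingProd y zero    = + 1
fallingProd y (suc k) = fallingProd y k * (y - + k)

Gtilde : ℕ → ℕ → ℤ → ℤ
Gtilde p zero    x = x
Gtilde p (suc n) x = divBy (fallingProd (Gtilde p n x) p) p

allTuples : (p n : ℕ) → List (Vec (Fin p) n)
allTuples p zero    = [] ∷ []
allTuples p (suc n) = concatMap (λ e → map (e ∷_) (allTuples p n)) (allFin p)

sumℤ : List ℤ → ℤ
sumℤ []       = + 0
sumℤ (z ∷ zs) = z + sumℤ zs

monoFrom : (p k : ℕ) {n : ℕ} → Vec (Fin p) n → ℤ → ℤ
monoFrom p k []       x = + 1
monoFrom p k (e ∷ es) x = (Gtilde p (suc k) x ^ toℕ e) * monoFrom p (suc k) es x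

mono : (p : ℕ) {n : ℕ} → Vec (Fin p) n → ℤ → ℤ
mono p e x = monoFrom p 0 e x

combo : (p n : ℕ) → (Vec (Fin p) n → IntPoly) → ℤ → ℤ
combo p n q x = sumℤ (map (λ e → mono p e x * eval (q e) x) (allTuples p n))

module Submission where

-- Modulo p, G̃_{p,j} is affine with a unit slope on each class x + p^j ℤ: G̃_{p,j}(x + p^j s) = G̃_{p,j}(x) + s w
-- with w ≡ c (mod p), p ∤ c; in particular it is p^(j+1)-periodic mod p. Proceed by induction on the number of
-- variables, peeling off the first one: grouping the sum by e₁, the grouped coefficients Σ_{e₁} G̃_{p,1}^{e₁} q_{e₁…}
-- are p²-periodic, so the induction hypothesis (with every index shifted by one) makes them vanish mod p. Then, as
-- x runs over x + p m (m < p), G̃_{p,1}(x) runs over p distinct residues while each q stays fixed mod p, so the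
-- polynomial Σ_{e₁} q_{e₁…}(x) t^{e₁} of degree < p has p roots mod p, and all its coefficients vanish mod p.

open import Defs
open import Data.Nat using (ℕ; _≥_)
open import Data.Nat.Primality using (Prime)
open import Data.Integer using (ℤ; +_)
open import Data.Fin using (Fin)
open import Data.Vec using (Vec)

open import Data.Nat as ℕ using (zero; suc; _<_; _≤_; s≤s; NonZero)
import Data.Nat.Properties as ℕ
import Data.Nat.DivMod as ℕ
open import Data.Nat.Divisibility using (>⇒∤; n∣m⇒m%n≡0) renaming (_∣_ to _ℕ∣_)
open import Data.Nat.Primality using (euclidsLemma; prime⇒nonZero; prime⇒nonTrivial)
open import Data.Integer as ℤ using (_+_; _-_; _*_; -_; _^_; _/ℕ_; _%ℕ_)
import Data.Integer.Properties as ℤ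
open import Data.Integer.DivMod using (a≡a%ℕn+[a/ℕn]*n; n%ℕd<d)
open import Data.Integer.Tactic.RingSolver using (solve-∀)
open import Data.Fin using (toℕ)
open import Data.Vec using ([]; _∷_)
open import Data.List using (List; []; _∷_; map; _++_; concatMap; length; tabulate; allFin; applyUpTo)
import Data.List.Properties as List
open import Data.List.Relation.Unary.All as All using (All; []; _∷_)
import Data.List.Relation.Unary.All.Properties as All
open import Data.List.Relation.Unary.AllPairs using (AllPairs; _∷_)
import Data.List.Relation.Unary.AllPairs.Properties as AllPairs
open import Data.Product using (∃-syntax; _×_; _,_)
open import Data.Sum as Sum using (_⊎_)
open import Data.Empty using (⊥-elim)
open import Function using (id; _∘_)
open import Relation.Nullary using (¬_)
open import Relation.Binary.PropositionalEquality
open ≡-Reasoning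

-- Signed divisibility is used throughout; the theorem is stated with the unsigned one.
module ModularIndependence where

  open import Data.Integer.Divisibility.Signed using (_∣_; divides; ∣ᵤ⇒∣; ∣⇒∣ᵤ)
  import Data.Integer.Divisibility.Signed as ∣

  ∑ : {A : Set} → List A → (A → ℤ) → ℤ
  ∑ xs f = sumℤ (map f xs)

  ∑-cong : ∀ {A : Set} (xs : List A) {f g : A → ℤ} → (∀ a → f a ≡ g a) → ∑ xs f ≡ ∑ xs g
  ∑-cong xs f≗g = cong sumℤ (List.map-cong f≗g xs)

  ∑-++ : ∀ {A : Set} (xs ys : List A) (f : A → ℤ) → ∑ (xs ++ ys) f ≡ ∑ xs f + ∑ ys f
  ∑-++ []       ys f = sym (ℤ.+-identityˡ _)
  ∑-++ (x ∷ xs) ys f = trans (cong (_+_ (f x)) (∑-++ xs ys f)) (sym (ℤ.+-assoc (f x) _ _))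

  ∑-map : ∀ {A B : Set} (g : A → B) (xs : List A) (f : B → ℤ) → ∑ (map g xs) f ≡ ∑ xs (f ∘ g)
  ∑-map g []       f = refl
  ∑-map g (x ∷ xs) f = cong (_+_ (f (g x))) (∑-map g xs f)

  ∑-concatMap : ∀ {A B : Set} (h : A → List B) (xs : List A) (f : B → ℤ) →
                ∑ (concatMap h xs) f ≡ ∑ xs (λ a → ∑ (h a) f)
  ∑-concatMap h []       f = refl
  ∑-concatMap h (x ∷ xs) f = trans (∑-++ (h x) _ f) (cong (_+_ (∑ (h x) f)) (∑-concatMap h xs f))

  ∑-zero : ∀ {A : Set} (xs : List A) → ∑ xs (λ _ → + 0) ≡ + 0
  ∑-zero []       = refl
  ∑-zero (x ∷ xs) = trans (ℤ.+-identityˡ _) (∑-zero xs)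

  ∑-+ : ∀ {A : Set} (xs : List A) (f g : A → ℤ) → ∑ xs (λ a → f a + g a) ≡ ∑ xs f + ∑ xs g
  ∑-+ []       f g = refl
  ∑-+ (x ∷ xs) f g = trans (cong (_+_ (f x + g x)) (∑-+ xs f g)) (interchange (f x) (g x) _ _)
    where
    interchange : ∀ a b c d → a + b + (c + d) ≡ (a + c) + (b + d)
    interchange = solve-∀

  ∑-comm : ∀ {A B : Set} (xs : List A) (ys : List B) (h : A → B → ℤ) →
           ∑ xs (λ a → ∑ ys (h a)) ≡ ∑ ys (λ b → ∑ xs (λ a → h a b))
  ∑-comm []       ys h = sym (∑-zero ys)
  ∑-comm (x ∷ xs) ys h =
    trans (cong (_+_ (∑ ys (h x))) (∑-comm xs ys h)) (sym (∑-+ ys (h x) _))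

  ∑-*ˡ : ∀ {A : Set} c (xs : List A) (f : A → ℤ) → ∑ xs (λ a → c * f a) ≡ c * ∑ xs f
  ∑-*ˡ c []       f = sym (ℤ.*-zeroʳ c)
  ∑-*ˡ c (x ∷ xs) f = trans (cong (_+_ (c * f x)) (∑-*ˡ c xs f)) (sym (ℤ.*-distribˡ-+ c (f x) _))

  ∑-allFin-suc : ∀ n (f : Fin (suc n) → ℤ) → ∑ (allFin (suc n)) f ≡ f Fin.zero + ∑ (allFin n) (f ∘ Fin.suc)
  ∑-allFin-suc n f =
    cong (λ xs → f Fin.zero + sumℤ xs)
         (trans (List.map-tabulate Fin.suc f) (sym (List.map-tabulate id (f ∘ Fin.suc))))

  ∑-powers : ∀ n (v : Fin n → ℤ) t → ∑ (allFin n) (λ a → t ^ toℕ a * v a) ≡ eval (tabulate v) t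
  ∑-powers zero    v t = refl
  ∑-powers (suc n) v t = begin
    ∑ (allFin (suc n)) (λ a → t ^ toℕ a * v a)
      ≡⟨ ∑-allFin-suc n (λ a → t ^ toℕ a * v a) ⟩
    + 1 * v Fin.zero + ∑ (allFin n) (λ a → t * t ^ toℕ a * v (Fin.suc a))
      ≡⟨ cong₂ _+_ (ℤ.*-identityˡ (v Fin.zero)) (∑-cong (allFin n) (λ a → ℤ.*-assoc t (t ^ toℕ a) (v (Fin.suc a)))) ⟩
    v Fin.zero + ∑ (allFin n) (λ a → t * (t ^ toℕ a * v (Fin.suc a)))
      ≡⟨ cong (_+_ (v Fin.zero)) (∑-*ˡ t (allFin n) _) ⟩
    v Fin.zero + t * ∑ (allFin n) (λ a → t ^ toℕ a * v (Fin.suc a))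
      ≡⟨ cong (λ s → v Fin.zero + t * s) (∑-powers n (v ∘ Fin.suc) t) ⟩
    eval (tabulate v) t ∎

  infix 4 _≡_mod_
  record _≡_mod_ (a b d : ℤ) : Set where
    constructor mk≡mod
    field divides-difference : d ∣ a - b

  module _ {d : ℤ} where

    mod-reflexive : ∀ {a b} → a ≡ b → a ≡ b mod d
    mod-reflexive {a} refl = mk≡mod (divides (+ 0) (trans (ℤ.+-inverseʳ a) (sym (ℤ.*-zeroˡ d))))

    mod-refl : ∀ {a} → a ≡ a mod d
    mod-refl = mod-reflexive refl

    mod-trans : ∀ {a b c} → a ≡ b mod d → b ≡ c mod d → a ≡ c mod d
    mod-trans {a} {b} {c} (mk≡mod a-b) (mk≡mod b-c) = mk≡mod (subst (d ∣_) (telescope a b c) (∣.∣m∣n⇒∣m+n a-b b-c))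
      where
      telescope : ∀ a b c → (a - b) + (b - c) ≡ a - c
      telescope = solve-∀

    mod-+ : ∀ {a b c e} → a ≡ b mod d → c ≡ e mod d → a + c ≡ b + e mod d
    mod-+ {a} {b} {c} {e} (mk≡mod a-b) (mk≡mod c-e) = mk≡mod (subst (d ∣_) (regroup a b c e) (∣.∣m∣n⇒∣m+n a-b c-e))
      where
      regroup : ∀ a b c e → (a - b) + (c - e) ≡ (a + c) - (b + e)
      regroup = solve-∀

    mod-* : ∀ {a b c e} → a ≡ b mod d → c ≡ e mod d → a * c ≡ b * e mod d
    mod-* {a} {b} {c} {e} (mk≡mod a-b) (mk≡mod c-e) =
      mk≡mod (subst (d ∣_) (regroup a b c e) (∣.∣m∣n⇒∣m+n (∣.∣n⇒∣m*n a c-e) (∣.∣m⇒∣m*n e a-b)))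
      where
      regroup : ∀ a b c e → a * (c - e) + (a - b) * e ≡ a * c - b * e
      regroup = solve-∀

    mod-^ : ∀ {a b} n → a ≡ b mod d → a ^ n ≡ b ^ n mod d
    mod-^ zero    a≡b = mod-refl
    mod-^ (suc n) a≡b = mod-* a≡b (mod-^ n a≡b)

    mod-∑ : ∀ {A : Set} (xs : List A) {f g : A → ℤ} → (∀ a → f a ≡ g a mod d) → ∑ xs f ≡ ∑ xs g mod d
    mod-∑ []       f≡g = mod-refl
    mod-∑ (x ∷ xs) f≡g = mod-+ (f≡g x) (mod-∑ xs f≡g)

    mod-eval : ∀ f {x y} → x ≡ y mod d → eval f x ≡ eval f y mod d
    mod-eval []       x≡y = mod-refl
    mod-eval (c ∷ cs) x≡y = mod-+ (mod-refl {c}) (mod-* x≡y (mod-eval cs x≡y))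

    mod-fallingProd : ∀ k {x y} → x ≡ y mod d → fallingProd x k ≡ fallingProd y k mod d
    mod-fallingProd zero    x≡y = mod-refl
    mod-fallingProd (suc k) x≡y = mod-* (mod-fallingProd k x≡y) (mod-+ x≡y (mod-refl { - + k}))

    mod-∣ : ∀ {a b} → a ≡ b mod d → d ∣ a → d ∣ b
    mod-∣ {a} {b} (mk≡mod a-b) d∣a = subst (d ∣_) (cancel a b) (∣.∣m∣n⇒∣m-n d∣a a-b)
      where
      cancel : ∀ a b → a - (a - b) ≡ b
      cancel = solve-∀

    mod-multiple : ∀ a k → a + k * d ≡ a mod d
    mod-multiple a k = mk≡mod (divides k (cancel a (k * d)))
      where
      cancel : ∀ a b → a + b - a ≡ b
      cancel = solve-∀

  horner : ℤ → IntPoly → IntPoly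
  horner t₀ []       = []
  horner t₀ (c ∷ cs) = eval (c ∷ cs) t₀ ∷ horner t₀ cs

  eval-horner : ∀ t₀ c cs t → eval (c ∷ cs) t ≡ eval (c ∷ cs) t₀ + (t - t₀) * eval (horner t₀ cs) t
  eval-horner t₀ c []       t = constant c t t₀
    where
    constant : ∀ c t t₀ → c + t * + 0 ≡ c + t₀ * + 0 + (t - t₀) * + 0
    constant = solve-∀
  eval-horner t₀ c (d ∷ ds) t = begin
    c + t * eval (d ∷ ds) t                         ≡⟨ cong (λ v → c + t * v) (eval-horner t₀ d ds t) ⟩
    c + t * (eval (d ∷ ds) t₀ + (t - t₀) * rest)    ≡⟨ regroup c t t₀ (eval (d ∷ ds) t₀) rest ⟩
    c + t₀ * eval (d ∷ ds) t₀ + (t - t₀) * (eval (d ∷ ds) t₀ + t * rest) ∎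
    where
    rest = eval (horner t₀ ds) t
    regroup : ∀ c t t₀ e r → c + t * (e + (t - t₀) * r) ≡ c + t₀ * e + (t - t₀) * (e + t * r)
    regroup = solve-∀

  length-horner : ∀ t₀ f → length (horner t₀ f) ≡ length f
  length-horner t₀ []       = refl
  length-horner t₀ (c ∷ cs) = cong suc (length-horner t₀ cs)

  ∣-eval : ∀ {d} f t → All (d ∣_) f → d ∣ eval f t
  ∣-eval {d} []       t []           = divides (+ 0) (sym (ℤ.*-zeroˡ d))
  ∣-eval     (c ∷ cs) t (d∣c ∷ d∣cs) = ∣.∣m∣n⇒∣m+n d∣c (∣.∣n⇒∣m*n t (∣-eval cs t d∣cs))

  ∣-horner⇒∣-coefficients : ∀ {d} t₀ f → All (d ∣_) (horner t₀ f) → All (d ∣_) f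
  ∣-horner⇒∣-coefficients t₀ []       []           = []
  ∣-horner⇒∣-coefficients t₀ (c ∷ cs) (d∣f₀ ∷ d∣h) =
    ∣.∣m+n∣n⇒∣m d∣f₀ (∣.∣n⇒∣m*n t₀ (∣-eval cs t₀ d∣cs)) ∷ d∣cs
    where
    d∣cs = ∣-horner⇒∣-coefficients t₀ cs d∣h

  fallingProd-+ : ∀ y b r → fallingProd y (r ℕ.+ b) ≡ fallingProd y b * fallingProd (y - + b) r
  fallingProd-+ y b zero    = sym (ℤ.*-identityʳ _)
  fallingProd-+ y b (suc r) = begin
    fallingProd y (r ℕ.+ b) * (y - + (r ℕ.+ b))
      ≡⟨ cong₂ _*_ (fallingProd-+ y b r) (cong (λ s → y - s) (ℤ.pos-+ r b)) ⟩
    fallingProd y b * fallingProd (y - + b) r * (y - (+ r + + b))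
      ≡⟨ regroup (fallingProd y b) (fallingProd (y - + b) r) y (+ r) (+ b) ⟩
    fallingProd y b * fallingProd (y - + b) (suc r) ∎
    where
    regroup : ∀ F G y r b → F * G * (y - (r + b)) ≡ F * (G * (y - b - r))
    regroup = solve-∀

  /ℕ-exact : ∀ w d .{{_ : NonZero d}} → (w * + d) /ℕ d ≡ w
  /ℕ-exact w d = sym (ℤ.*-cancelʳ-≡ w q (+ d) (begin
    w * + d          ≡⟨ division ⟩
    + r + q * + d    ≡⟨ cong (λ s → + s + q * + d) r≡0 ⟩
    + 0 + q * + d    ≡⟨ ℤ.+-identityˡ (q * + d) ⟩
    q * + d          ∎))
    where
    q = (w * + d) /ℕ d
    r = (w * + d) %ℕ d
    division : w * + d ≡ + r + q * + d
    division = a≡a%ℕn+[a/ℕn]*n (w * + d) d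
    remainder : + r ≡ (w - q) * + d
    remainder = trans (isolate (+ r) q (+ d)) (trans (cong (_- q * + d) (sym division)) (factor w q (+ d)))
      where
      isolate : ∀ r q D → r ≡ r + q * D - q * D
      isolate = solve-∀
      factor : ∀ w q D → w * D - q * D ≡ (w - q) * D
      factor = solve-∀
    r≡0 : r ≡ 0
    r≡0 = trans (sym (ℕ.m<n⇒m%n≡m (n%ℕd<d (w * + d) d)))
                (n∣m⇒m%n≡0 r d (∣⇒∣ᵤ (divides (w - q) remainder)))

  divBy-exact : ∀ w d .{{_ : NonZero d}} → divBy (w * + d) d ≡ w
  divBy-exact w (suc d) = /ℕ-exact w (suc d)

  +-^-suc : ∀ x b k m → x + b ^ suc k * m ≡ x + b ^ k * (b * m)
  +-^-suc x b k m = shuffle x b (b ^ k) m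
    where
    shuffle : ∀ x b bᵏ m → x + b * bᵏ * m ≡ x + bᵏ * (b * m)
    shuffle = solve-∀

  module _ (p : ℕ) (p-prime : Prime p) where

    P : ℤ
    P = + p

    instance
      p-nonZero : NonZero p
      p-nonZero = prime⇒nonZero p-prime

    ∣m*n⇒∣m⊎∣n : ∀ {a b} → P ∣ a * b → (P ∣ a) ⊎ (P ∣ b)
    ∣m*n⇒∣m⊎∣n {a} {b} p∣ab =
      Sum.map ∣ᵤ⇒∣ ∣ᵤ⇒∣ (euclidsLemma ℤ.∣ a ∣ ℤ.∣ b ∣ p-prime (subst (p ℕ∣_) (ℤ.abs-* a b) (∣⇒∣ᵤ p∣ab)))

    ∤-* : ∀ {a b} → ¬ P ∣ a → ¬ P ∣ b → ¬ P ∣ a * b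
    ∤-* p∤a p∤b p∣ab = Sum.[ p∤a , p∤b ] (∣m*n⇒∣m⊎∣n p∣ab)

    ∣-cancelˡ : ∀ {a b} → ¬ P ∣ a → P ∣ a * b → P ∣ b
    ∣-cancelˡ p∤a p∣ab = Sum.[ ⊥-elim ∘ p∤a , id ] (∣m*n⇒∣m⊎∣n p∣ab)

    ∤-positive : ∀ {m} → 0 < m → m < p → ¬ P ∣ + m
    ∤-positive {suc m} _ m<p p∣m = >⇒∤ m<p (∣⇒∣ᵤ p∣m)

    ∤-1 : ¬ P ∣ + 1
    ∤-1 = ∤-positive (s≤s ℕ.z≤n) (ℕ.nonTrivial⇒n>1 p {{prime⇒nonTrivial p-prime}})

    ∤-difference : ∀ {i j} → i < j → j < p → ¬ P ∣ + j - + i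
    ∤-difference {i} {j} i<j j<p =
      subst (λ z → ¬ P ∣ z) (sym (trans (ℤ.m-n≡m⊖n j i) (ℤ.⊖-≥ (ℕ.<⇒≤ i<j))))
            (∤-positive (ℕ.m<n⇒0<n∸m i<j) (ℕ.≤-<-trans (ℕ.m∸n≤m j i) j<p))

    ∤-fallingProd : ∀ y k → (∀ i → i < k → ¬ P ∣ y - + i) → ¬ P ∣ fallingProd y k
    ∤-fallingProd y zero    _     = ∤-1
    ∤-fallingProd y (suc k) p∤y-i =
      ∤-* (∤-fallingProd y k (λ i i<k → p∤y-i i (ℕ.m<n⇒m<1+n i<k))) (p∤y-i k (ℕ.n<1+n k))

    DistinctMod : List ℤ → Set
    DistinctMod = AllPairs (λ a b → ¬ P ∣ b - a)

    roots⇒∣-coefficients : ∀ ts f → length f ≤ length ts → DistinctMod ts →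
                           All (λ t → P ∣ eval f t) ts → All (P ∣_) f
    roots⇒∣-coefficients ts        []       _         _                  _               = []
    roots⇒∣-coefficients (t₀ ∷ ts) (c ∷ cs) (s≤s len) (t₀≢ts ∷ distinct) (f[t₀] ∷ f[ts]) =
      ∣-horner⇒∣-coefficients t₀ (c ∷ cs)
        (f[t₀] ∷ roots⇒∣-coefficients ts (horner t₀ cs) (subst (_≤ length ts) (sym (length-horner t₀ cs)) len)
                   distinct (All.zipWith quotient-root (t₀≢ts , f[ts])))
      where
      quotient-root : ∀ {t} → ¬ P ∣ t - t₀ × P ∣ eval (c ∷ cs) t → P ∣ eval (horner t₀ cs) t
      quotient-root {t} (p∤t-t₀ , f[t]) =
        ∣-cancelˡ p∤t-t₀ (∣.∣m+n∣m⇒∣n (subst (P ∣_) (eval-horner t₀ c cs t) f[t]) f[t₀])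

    roots-on-progression⇒∣-coefficients : ∀ f t₀ {w} → length f ≤ p → ¬ P ∣ w →
      (∀ m → m < p → P ∣ eval f (t₀ + + m * w)) → All (P ∣_) f
    roots-on-progression⇒∣-coefficients f t₀ {w} len p∤w roots =
      roots⇒∣-coefficients (applyUpTo point p) f
        (subst (length f ≤_) (sym (List.length-applyUpTo point p)) len)
        (AllPairs.applyUpTo⁺₁ point p distinct)
        (All.applyUpTo⁺₁ point p (λ {m} → roots m))
      where
      point : ℕ → ℤ
      point m = t₀ + + m * w
      distinct : ∀ {i j} → i < j → j < p → ¬ P ∣ point j - point i
      distinct {i} {j} i<j j<p = subst (λ z → ¬ P ∣ z) (difference t₀ (+ i) (+ j) w) (∤-* (∤-difference i<j j<p) p∤w)
        where
        difference : ∀ t₀ i j w → (j - i) * w ≡ (t₀ + j * w) - (t₀ + i * w)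
        difference = solve-∀

    G̃-step : ℤ → ℤ
    G̃-step y = divBy (fallingProd y p) p

    Periodic : ℕ → (ℤ → ℤ) → Set
    Periodic k f = ∀ x m → f (x + P ^ k * m) ≡ f x mod P

    periodic-suc : ∀ {k f} → Periodic k f → Periodic (suc k) f
    periodic-suc {k} {f} per x m = mod-trans (mod-reflexive (cong f (+-^-suc x P k m))) (per x (P * m))

    record UnitSlope (k : ℕ) (f : ℤ → ℤ) (x : ℤ) : Set where
      field
        slope   : ℤ
        slope-∤ : ¬ P ∣ slope
        expand  : ∀ s → ∃[ w ] w ≡ slope mod P × f (x + P ^ k * s) ≡ f x + s * w
    open UnitSlope

    unitSlope-id : ∀ x → UnitSlope 0 id x
    unitSlope-id x = record { slope = + 1 ; slope-∤ = ∤-1 ; expand = λ s → + 1 , mod-refl , commute x s }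
      where
      commute : ∀ x s → x + + 1 * s ≡ x + s * + 1
      commute = solve-∀

    unitSlope-∘ : ∀ {j f g x} (sf : UnitSlope j f x) → UnitSlope 1 g (f x) → UnitSlope (suc j) (g ∘ f) x
    unitSlope-∘ {j} {f} {g} {x} sf sg =
      record { slope = slope sf * slope sg ; slope-∤ = ∤-* (slope-∤ sf) (slope-∤ sg) ; expand = expand-∘ }
      where
      reassociate : ∀ y P s w → y + P * s * w ≡ y + P * + 1 * (s * w)
      reassociate = solve-∀
      expand-∘ : ∀ s → ∃[ w ] w ≡ slope sf * slope sg mod P × g (f (x + P ^ suc j * s)) ≡ g (f x) + s * w
      expand-∘ s with expand sf (P * s)
      ... | w , w≡ , f-eq with expand sg (s * w)
      ... | w′ , w′≡ , g-eq = w * w′ , mod-* w≡ w′≡ , (begin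
        g (f (x + P ^ suc j * s))    ≡⟨ cong (g ∘ f) (+-^-suc x P j s) ⟩
        g (f (x + P ^ j * (P * s)))  ≡⟨ cong g (trans f-eq (reassociate (f x) P s w)) ⟩
        g (f x + P ^ 1 * (s * w))    ≡⟨ g-eq ⟩
        g (f x) + s * w * w′         ≡⟨ cong (_+_ (g (f x))) (ℤ.*-assoc s w w′) ⟩
        g (f x) + s * (w * w′)       ∎)

    unitSlope⇒periodic : ∀ {j f} → (∀ x → UnitSlope j f x) → Periodic (suc j) f
    unitSlope⇒periodic {j} {f} sf x m with expand (sf x) (P * m)
    ... | w , _ , f-eq =
      mod-trans (mod-reflexive (trans (cong f (+-^-suc x P j m)) (trans f-eq (reorder (f x) P m w))))
                (mod-multiple (f x) (m * w))
      where
      reorder : ∀ y P m w → y + P * m * w ≡ y + m * w * P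
      reorder = solve-∀

    unitSlope-progression : ∀ {j f x} (sf : UnitSlope j f x) m → f (x + P ^ j * m) ≡ f x + m * slope sf mod P
    unitSlope-progression {f = f} {x} sf m with expand sf m
    ... | w , w≡ , f-eq = mod-trans (mod-reflexive f-eq) (mod-+ (mod-refl {a = f x}) (mod-* (mod-refl {a = m}) w≡))

    module ResidueClass {a : ℕ} (a<p : a < p) where

      r : ℕ
      r = p ℕ.∸ suc a

      Q : ℤ → ℤ
      Q z = fallingProd z a * fallingProd (z - + suc a) r

      fallingProd-p : ∀ z → fallingProd z p ≡ (z - + a) * Q z
      fallingProd-p z = begin
        fallingProd z p                                           ≡⟨ cong (fallingProd z) (sym (ℕ.m∸n+n≡m a<p)) ⟩
        fallingProd z (r ℕ.+ suc a)                               ≡⟨ fallingProd-+ z (suc a) r ⟩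
        fallingProd z a * (z - + a) * fallingProd (z - + suc a) r ≡⟨ regroup (fallingProd z a) (z - + a) _ ⟩
        (z - + a) * Q z                                           ∎
        where
        regroup : ∀ F D G → F * D * G ≡ D * (F * G)
        regroup = solve-∀

      Q-cong : ∀ {d x y} → x ≡ y mod d → Q x ≡ Q y mod d
      Q-cong x≡y = mod-* (mod-fallingProd a x≡y) (mod-fallingProd r (mod-+ x≡y mod-refl))

      Q[a]-∤ : ¬ P ∣ Q (+ a)
      Q[a]-∤ = ∤-* (∤-fallingProd (+ a) a (λ i i<a → ∤-difference i<a a<p)) (∤-fallingProd (+ a - + suc a) r below)
        where
        negate : ∀ A B I → - ((A - B) - I) ≡ (B + I) - A
        negate = solve-∀
        below : ∀ i → i < r → ¬ P ∣ (+ a - + suc a) - + i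
        below i i<r p∣ = ∤-difference {a} {suc a ℕ.+ i} (s≤s (ℕ.m≤m+n a i))
          (subst (suc a ℕ.+ i <_) (ℕ.m+[n∸m]≡n a<p) (ℕ.+-monoʳ-< (suc a) i<r))
          (subst (P ∣_) (trans (negate (+ a) (+ suc a) (+ i)) (cong (_- + a) (sym (ℤ.pos-+ (suc a) i)))) (∣.∣m⇒∣-m p∣))

      G̃-step-on-class : ∀ u → G̃-step (+ a + u * P) ≡ u * Q (+ a + u * P)
      G̃-step-on-class u =
        trans (cong (λ v → divBy v p) (trans (fallingProd-p z) (extract (+ a) u P (Q z)))) (divBy-exact (u * Q z) p)
        where
        z = + a + u * P
        extract : ∀ A u P Q → (A + u * P - A) * Q ≡ u * Q * P
        extract = solve-∀

      unitSlope : ∀ t → UnitSlope 1 G̃-step (+ a + t * P)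
      unitSlope t = record { slope = Q (+ a) ; slope-∤ = Q[a]-∤ ; expand = expand-step }
        where
        step-difference : ∀ A t s P → (A + (t + s) * P) - (A + t * P) ≡ + 1 * (s * P)
        step-difference = solve-∀
        merge : ∀ A t P s → A + t * P + P * + 1 * s ≡ A + (t + s) * P
        merge = solve-∀
        split : ∀ t s Q₁ Q₀ → (t + s) * Q₁ ≡ t * Q₀ + s * Q₁ + t * (Q₁ - Q₀)
        split = solve-∀
        gather : ∀ t s Q₁ Q₀ k P → t * Q₀ + s * Q₁ + t * (k * (s * P)) ≡ t * Q₀ + s * (Q₁ + t * k * P)
        gather = solve-∀
        -- Q z₁ − Q z₀ is divisible by z₁ − z₀ = s p, so the increment of u · Q (a + u p) is a multiple of s.
        expand-step : ∀ s → ∃[ w ] w ≡ Q (+ a) mod P ×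
                      G̃-step (+ a + t * P + P ^ 1 * s) ≡ G̃-step (+ a + t * P) + s * w
        expand-step s with Q-cong {s * P} (mk≡mod (divides (+ 1) (step-difference (+ a) t s P)))
        ... | mk≡mod (divides k Q-difference) =
          Q₁ + t * k * P , mod-trans (mod-multiple Q₁ (t * k)) (Q-cong (mod-multiple (+ a) (t + s))) , (begin
            G̃-step (+ a + t * P + P ^ 1 * s)        ≡⟨ cong G̃-step (merge (+ a) t P s) ⟩
            G̃-step (+ a + (t + s) * P)              ≡⟨ G̃-step-on-class (t + s) ⟩
            (t + s) * Q₁                             ≡⟨ split t s Q₁ Q₀ ⟩
            t * Q₀ + s * Q₁ + t * (Q₁ - Q₀)          ≡⟨ cong (λ D → t * Q₀ + s * Q₁ + t * D) Q-difference ⟩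
            t * Q₀ + s * Q₁ + t * (k * (s * P))      ≡⟨ gather t s Q₁ Q₀ k P ⟩
            t * Q₀ + s * (Q₁ + t * k * P)            ≡⟨ cong (_+ s * (Q₁ + t * k * P)) (sym (G̃-step-on-class t)) ⟩
            G̃-step (+ a + t * P) + s * (Q₁ + t * k * P) ∎)
          where
          Q₁ = Q (+ a + (t + s) * P)
          Q₀ = Q (+ a + t * P)

    G̃-step-slope : ∀ y → UnitSlope 1 G̃-step y
    G̃-step-slope y =
      subst (UnitSlope 1 G̃-step) (sym (a≡a%ℕn+[a/ℕn]*n y p)) (ResidueClass.unitSlope (n%ℕd<d y p) (y /ℕ p))

    G̃-slope : ∀ j x → UnitSlope j (Gtilde p j) x
    G̃-slope zero    x = unitSlope-id x
    G̃-slope (suc j) x = unitSlope-∘ (G̃-slope j x) (G̃-step-slope (Gtilde p j x))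

    combination : (k n : ℕ) → (Vec (Fin p) n → ℤ → ℤ) → ℤ → ℤ
    combination k n c x = ∑ (allTuples p n) (λ e → monoFrom p k e x * c e x)

    absorb : ∀ {n} (k : ℕ) → (Vec (Fin p) (suc n) → ℤ → ℤ) → Vec (Fin p) n → ℤ → ℤ
    absorb k c es x = ∑ (allFin p) (λ a → Gtilde p (suc k) x ^ toℕ a * c (a ∷ es) x)

    combination-suc : ∀ k n c x → combination k (suc n) c x ≡ combination (suc k) n (absorb k c) x
    combination-suc k n c x = begin
      ∑ (concatMap (λ a → map (a ∷_) tuples) (allFin p)) term
        ≡⟨ ∑-concatMap (λ a → map (a ∷_) tuples) (allFin p) term ⟩
      ∑ (allFin p) (λ a → ∑ (map (a ∷_) tuples) term)
        ≡⟨ ∑-cong (allFin p) (λ a → ∑-map (a ∷_) tuples term) ⟩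
      ∑ (allFin p) (λ a → ∑ tuples (λ es → term (a ∷ es)))
        ≡⟨ ∑-comm (allFin p) tuples (λ a es → term (a ∷ es)) ⟩
      ∑ tuples (λ es → ∑ (allFin p) (λ a → term (a ∷ es)))
        ≡⟨ ∑-cong tuples factor-out ⟩
      combination (suc k) n (absorb k c) x ∎
      where
      tuples = allTuples p n
      term : Vec (Fin p) (suc n) → ℤ
      term e = monoFrom p k e x * c e x
      regroup : ∀ g M c → g * M * c ≡ M * (g * c)
      regroup = solve-∀
      factor-out : ∀ es → ∑ (allFin p) (λ a → term (a ∷ es)) ≡ monoFrom p (suc k) es x * absorb k c es x
      factor-out es = trans (∑-cong (allFin p) (λ a → regroup (Gᵃ a) M (c (a ∷ es) x)))
                            (∑-*ˡ M (allFin p) (λ a → Gᵃ a * c (a ∷ es) x))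
        where
        M = monoFrom p (suc k) es x
        Gᵃ : Fin p → ℤ
        Gᵃ a = Gtilde p (suc k) x ^ toℕ a

    absorb-periodic : ∀ {n} k (c : Vec (Fin p) (suc n) → ℤ → ℤ) → (∀ e → Periodic (suc k) (c e)) →
                      ∀ es → Periodic (suc (suc k)) (absorb k c es)
    absorb-periodic k c per es x m = mod-∑ (allFin p) (λ a →
      mod-* (mod-^ (toℕ a) (unitSlope⇒periodic (G̃-slope (suc k)) x m)) (periodic-suc {suc k} (per (a ∷ es)) x m))

    monomials-independent : ∀ n k (c : Vec (Fin p) n → ℤ → ℤ) → (∀ e → Periodic (suc k) (c e)) →
                            (∀ x → P ∣ combination k n c x) → ∀ e x → P ∣ c e x
    monomials-independent zero    k c _   p∣comb [] x = subst (P ∣_) (trivial (c [] x)) (p∣comb x)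
      where
      trivial : ∀ z → + 1 * z + + 0 ≡ z
      trivial = solve-∀
    monomials-independent (suc n) k c per p∣comb (a ∷ es) x =
      All.tabulate⁻ (roots-on-progression⇒∣-coefficients (tabulate coefficient) (Gtilde p (suc k) x)
                      (ℕ.≤-reflexive (List.length-tabulate coefficient)) (slope-∤ G̃ₖ₊₁) root) a
      where
      p∣absorb : ∀ x → P ∣ absorb k c es x
      p∣absorb = monomials-independent n (suc k) (absorb k c) (absorb-periodic k c per)
                   (λ x → subst (P ∣_) (combination-suc k n c x) (p∣comb x)) es
      G̃ₖ₊₁ : UnitSlope (suc k) (Gtilde p (suc k)) x
      G̃ₖ₊₁ = G̃-slope (suc k) x
      coefficient : Fin p → ℤ
      coefficient b = c (b ∷ es) x
      point : ℕ → ℤ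
      point m = Gtilde p (suc k) x + + m * slope G̃ₖ₊₁
      shifted : ∀ m → absorb k c es (x + P ^ suc k * + m) ≡ ∑ (allFin p) (λ b → point m ^ toℕ b * coefficient b) mod P
      shifted m = mod-∑ (allFin p) (λ b →
        mod-* (mod-^ (toℕ b) (unitSlope-progression G̃ₖ₊₁ (+ m))) (per (b ∷ es) x (+ m)))
      root : ∀ m → m < p → P ∣ eval (tabulate coefficient) (point m)
      root m _ = subst (P ∣_) (∑-powers p coefficient (point m)) (mod-∣ (shifted m) (p∣absorb (x + P ^ suc k * + m)))

open ModularIndependence
open import Data.Integer.Divisibility using (_∣_)
open import Data.Integer.Divisibility.Signed using (∣ᵤ⇒∣; ∣⇒∣ᵤ)

mainTheorem4 : (p n : ℕ) → Prime p → n ≥ 1 →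
    (q : Vec (Fin p) n → IntPoly) →
    (∀ (x : ℤ) → (+ p) ∣ combo p n q x) →
    ∀ (e : Vec (Fin p) n) → NullMod (q e) p
mainTheorem4 p n p-prime _ q p∣combo e x =
  ∣⇒∣ᵤ (monomials-independent p p-prime n 0 (eval ∘ q) eval-periodic (λ x → ∣ᵤ⇒∣ (p∣combo x)) e x)
  where
  shift : ∀ x P m → x + P * + 1 * m ≡ x + m * P
  shift = solve-∀
  eval-periodic : ∀ e → Periodic p p-prime 1 (eval (q e))
  eval-periodic e x m = mod-eval (q e) (mod-trans (mod-reflexive (shift x (+ p) m)) (mod-multiple x m))
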